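{- Let $A \in \mathbb{F}_2[x]$ be nonzero with Collatz sequence $(A_j)_{j\geq 0}$, valuations $a_{2k}, b_{2k}$, and put $d_k = \deg(A_{2k})$ and $\ell_k = \deg(A_{2k+1})$ for $k \geq 0$. Then for all $k \geq 0$: $\ell_{k+1} \leq \ell_k \leq \deg(A)$ and $d_k = \ell_k + a_{2k} + b_{2k}$; and for all $k \geq 1$: $d_k = \ell_{k-1} + 2$.
   Context: A polynomial $S \in \mathbb{F}_2[x]$ is called odd if $\gcd(S, x(x+1)) = 1$. Let $M_1 = x^2+x+1$. For nonzero $S$, $val_x(S)$ and $val_{x+1}(S)$ denote the exponents of $x$ and $x+1$ in $S$. For nonzero $A \in \mathbb{F}_2[x]$ define: $A_0 = A$; for every $k \geq 0$, $a_{2k} = val_x(A_{2k})$, $b_{2k} = val_{x+1}(A_{2k})$, $A_{2k+1} = A_{2k}/(x^{a_{2k}}(x+1)^{b_{2k}})$ (odd); and $A_{2k+2} = 1 + M_1 A_{2k+1}$. -}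

module Defs where

open import Data.Bool using (Bool; true; false; if_then_else_; _xor_)
open import Data.List using (List; []; _∷_; length; drop; foldr)
open import Data.List.Relation.Unary.Any using (Any)
open import Data.Nat using (ℕ; zero; suc; _∸_)
open import Data.Product using (_×_; _,_; proj₁; proj₂)
open import Relation.Binary.PropositionalEquality using (_≡_)

-- Polynomials over F₂ as little-endian coefficient lists:
-- (c₀ ∷ c₁ ∷ … ∷ cₙ ∷ []) represents c₀ + c₁ x + … + cₙ xⁿ.
-- Trailing zero coefficients are allowed (so equality of polynomials is
-- equality up to trailing falses); all notions below respect this.
Poly : Set
Poly = List Bool

NonZeroPoly : Poly → Set
NonZeroPoly p = Any (_≡ true) p

_⊕_ : Poly → Poly → Poly
[] ⊕ q = q
(a ∷ p) ⊕ [] = a ∷ p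
(a ∷ p) ⊕ (b ∷ q) = (a xor b) ∷ (p ⊕ q)

infixl 6 _⊕_
infixl 7 _·_

_·_ : Poly → Poly → Poly
[] · q = []
(a ∷ p) · q = (if a then q else []) ⊕ (false ∷ (p · q))

one : Poly
one = true ∷ []

M₁ : Poly
M₁ = true ∷ true ∷ true ∷ []

strip : Poly → Poly
strip [] = []
strip (a ∷ p) with strip p
... | [] = if a then true ∷ [] else []
... | b ∷ q = a ∷ b ∷ q

-- degree (for nonzero polynomials; the zero polynomial gets 0, never used)
deg : Poly → ℕ
deg p = length (strip p) ∸ 1

valX : Poly → ℕ
valX [] = 0
valX (false ∷ p) = suc (valX p)
valX (true ∷ p) = 0

eval1 : Poly → Bool
eval1 p = foldr _xor_ false p

-- quotient by (x+1) (exact when eval1 p ≡ false):  q_i = Σ_{j>i} p_j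
divX1 : Poly → Poly
divX1 [] = []
divX1 (a ∷ p) = eval1 p ∷ divX1 p

divX1* : ℕ → Poly → ℕ × Poly
divX1* zero p = 0 , p
divX1* (suc n) p with eval1 p
... | true = 0 , p
... | false with divX1* n (divX1 p)
...   | k , q = suc k , q

-- val_{x+1} of a nonzero polynomial (fuel length p > deg p suffices)
valX1 : Poly → ℕ
valX1 p = proj₁ (divX1* (length p) p)

oddPart : Poly → Poly
oddPart p = proj₂ (divX1* (length p) (drop (valX p) p))

isEven : ℕ → Bool
isEven zero = true
isEven (suc n) with isEven n
... | true = false
... | false = true

collatz : Poly → ℕ → Poly
collatz A zero = A
collatz A (suc j) with isEven j
... | true = oddPart (collatz A j)
... | false = one ⊕ M₁ · collatz A j

-- Measure polynomials by size p = deg p + 1 (size 0 = 0).  Stripping the factors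
-- x^a (x+1)^b from a nonzero polynomial lowers its size by exactly a + b and leaves
-- an odd polynomial: each division by x + 1 lowers the size by one, and the division
-- loop stops exactly when p(1) = 1.  For odd s, 1 + M₁ s has degree deg s + 2, and it
-- is divisible by x (constant term 1 + s(0) = 0) and by x + 1 (value 1 + s(1) = 0 at
-- 1).  Hence the next valuations satisfy a, b ≥ 1, and ℓ_{k+1} + a + b = d_{k+1} = ℓ_k + 2
-- gives ℓ_{k+1} ≤ ℓ_k.
module Submission where

open import Defs
open import Algebra using (CommutativeRing)
open import Data.Bool using (Bool; true; false; if_then_else_; _xor_; _∧_; not)
open import Data.Bool.Properties
  using (xor-identityʳ; xor-comm; ∧-distribʳ-xor; not-involutive; xor-∧-commutativeRing)
open import Data.List using ([]; _∷_; length; drop; head)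
open import Data.List.Properties using (length-drop)
open import Data.List.Relation.Unary.Any using (here; there)
open import Data.Maybe using (just)
open import Data.Nat using (ℕ; zero; suc; _+_; _*_; _∸_; _≤_; _<_; z≤n; s≤s; s≤s⁻¹)
open import Data.Nat.Properties
open import Data.Product using (_×_; _,_; proj₁; proj₂)
open import Relation.Binary.PropositionalEquality
open import Algebra.Properties.CommutativeSemigroup
  (CommutativeRing.+-commutativeSemigroup xor-∧-commutativeRing) using (interchange)
open import Algebra.Properties.CommutativeSemigroup +-commutativeSemigroup using (xy∙z≈xz∙y)

open ≡-Reasoning

-- Unlike deg, size separates the zero polynomial from the nonzero constants.
size : Poly → ℕ
size p = length (strip p)

consSize : Bool → ℕ → ℕ
consSize c (suc m) = suc (suc m)
consSize true zero = 1
consSize false zero = 0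

size-∷ : ∀ c p → size (c ∷ p) ≡ consSize c (size p)
size-∷ c p with strip p
size-∷ true p | [] = refl
size-∷ false p | [] = refl
... | _ ∷ _ = refl

size-∷-≡0 : ∀ c p → size (c ∷ p) ≡ 0 → c ≡ false × size p ≡ 0
size-∷-≡0 c p eq = consSize-≡0 c (size p) (trans (sym (size-∷ c p)) eq)
  where
  consSize-≡0 : ∀ c m → consSize c m ≡ 0 → c ≡ false × m ≡ 0
  consSize-≡0 false zero _ = refl , refl

size-∷-≡1 : ∀ c p → size (c ∷ p) ≡ 1 → c ≡ true × size p ≡ 0
size-∷-≡1 c p eq = consSize-≡1 c (size p) (trans (sym (size-∷ c p)) eq)
  where
  consSize-≡1 : ∀ c m → consSize c m ≡ 1 → c ≡ true × m ≡ 0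
  consSize-≡1 true zero _ = refl , refl

size-∷-pos : ∀ c p → 1 ≤ size p → size (c ∷ p) ≡ suc (size p)
size-∷-pos c p pos with size p | size-∷ c p
... | suc m | eq = eq

size-true∷-pos : ∀ p → 1 ≤ size (true ∷ p)
size-true∷-pos p with size p | size-∷ true p
... | zero | eq = ≤-reflexive (sym eq)
... | suc m | eq = ≤-trans (s≤s z≤n) (≤-reflexive (sym eq))

size-false∷-pos : ∀ p → 1 ≤ size (false ∷ p) → 1 ≤ size p
size-false∷-pos p pos with size p | size-∷ false p
... | zero | eq = subst (1 ≤_) eq pos
... | suc m | _ = s≤s z≤n

size≤length : ∀ p → size p ≤ length p
size≤length [] = z≤n
size≤length (c ∷ p) = ≤-trans (≤-reflexive (size-∷ c p)) (consSize≤suc c (size≤length p))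
  where
  consSize≤suc : ∀ c {m n} → m ≤ n → consSize c m ≤ suc n
  consSize≤suc c {suc m} m≤n = s≤s m≤n
  consSize≤suc true {zero} _ = s≤s z≤n
  consSize≤suc false {zero} _ = z≤n

nonZero⇒size-pos : ∀ p → NonZeroPoly p → 1 ≤ size p
nonZero⇒size-pos (.true ∷ p) (here refl) = size-true∷-pos p
nonZero⇒size-pos (c ∷ p) (there nz) =
  ≤-trans (s≤s z≤n) (≤-reflexive (sym (size-∷-pos c p (nonZero⇒size-pos p nz))))

size≡suc-deg : ∀ p → 1 ≤ size p → size p ≡ suc (deg p)
size≡suc-deg p pos with size p
... | suc m = refl

size-⊕-≡0 : ∀ p q → size p ≡ 0 → size q ≡ 0 → size (p ⊕ q) ≡ 0
size-⊕-≡0 [] q _ q0 = q0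
size-⊕-≡0 (a ∷ p) [] p0 _ = p0
size-⊕-≡0 (a ∷ p) (b ∷ q) p0 q0 with size-∷-≡0 a p p0 | size-∷-≡0 b q q0
... | refl , p0′ | refl , q0′ = begin
  size (false ∷ p ⊕ q)             ≡⟨ size-∷ false (p ⊕ q) ⟩
  consSize false (size (p ⊕ q))    ≡⟨ cong (consSize false) (size-⊕-≡0 p q p0′ q0′) ⟩
  0                                ∎

consSize-<-zero : ∀ a b n → consSize b n < consSize a 0 → a ≡ true × b ≡ false × n ≡ 0
consSize-<-zero true false zero _ = refl , refl , refl
consSize-<-zero true true zero (s≤s ())
consSize-<-zero true b (suc n) (s≤s ())

consSize-<-suc : ∀ a b n m → consSize b n < consSize a (suc m) → n < suc m
consSize-<-suc a b zero m _ = s≤s z≤n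
consSize-<-suc a b (suc n) m (s≤s n<m) = n<m

size-⊕-≡ˡ : ∀ p q → size q < size p → size (p ⊕ q) ≡ size p
size-⊕-≡ˡ (a ∷ p) [] _ = refl
size-⊕-≡ˡ (a ∷ p) (b ∷ q) q<p = begin
  size ((a xor b) ∷ p ⊕ q)              ≡⟨ size-∷ (a xor b) (p ⊕ q) ⟩
  consSize (a xor b) (size (p ⊕ q))     ≡⟨ tail-case (size p) refl ⟩
  consSize a (size p)                   ≡⟨ size-∷ a p ⟨
  size (a ∷ p)                          ∎
  where
  q<p′ : consSize b (size q) < consSize a (size p)
  q<p′ = subst₂ _<_ (size-∷ b q) (size-∷ a p) q<p
  tail-case : ∀ m → size p ≡ m → consSize (a xor b) (size (p ⊕ q)) ≡ consSize a m
  tail-case zero p0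
    with consSize-<-zero a b (size q) (subst (λ m → consSize b (size q) < consSize a m) p0 q<p′)
  ... | refl , refl , q0 = cong (consSize true) (size-⊕-≡0 p q p0 q0)
  tail-case (suc m) p≡ = cong (consSize (a xor b)) (trans (size-⊕-≡ˡ p q q<sm) p≡)
    where
    q<sm : size q < size p
    q<sm = subst (size q <_) (sym p≡)
      (consSize-<-suc a b (size q) m (subst (λ m → consSize b (size q) < consSize a m) p≡ q<p′))

⊕-comm : ∀ p q → p ⊕ q ≡ q ⊕ p
⊕-comm [] [] = refl
⊕-comm [] (b ∷ q) = refl
⊕-comm (a ∷ p) [] = refl
⊕-comm (a ∷ p) (b ∷ q) = cong₂ _∷_ (xor-comm a b) (⊕-comm p q)

size-⊕-≡ʳ : ∀ p q → size p < size q → size (p ⊕ q) ≡ size q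
size-⊕-≡ʳ p q p<q = trans (cong size (⊕-comm p q)) (size-⊕-≡ˡ q p p<q)

scale : Bool → Poly → Poly
scale a q = if a then q else []

size-scale≤ : ∀ a q → size (scale a q) ≤ size q
size-scale≤ true q = ≤-refl
size-scale≤ false q = z≤n

size-·-≡0 : ∀ p q → size p ≡ 0 → size (p · q) ≡ 0
size-·-≡0 [] q _ = refl
size-·-≡0 (a ∷ p) q p0 with size-∷-≡0 a p p0
... | refl , p0′ = begin
  size (false ∷ p · q)            ≡⟨ size-∷ false (p · q) ⟩
  consSize false (size (p · q))   ≡⟨ cong (consSize false) (size-·-≡0 p q p0′) ⟩
  0                               ∎

consSize-pos : ∀ a → 1 ≤ consSize a 0 → a ≡ true
consSize-pos true _ = refl

size-· : ∀ p q → 1 ≤ size p → 1 ≤ size q → suc (size (p · q)) ≡ size p + size q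
size-· (a ∷ p) q p-pos q-pos with size p in p≡
... | zero
  with consSize-pos a (subst (λ m → 1 ≤ consSize a m) p≡ (subst (1 ≤_) (size-∷ a p) p-pos))
...   | refl = begin
  suc (size (q ⊕ (false ∷ p · q)))   ≡⟨ cong suc (size-⊕-≡ˡ q (false ∷ p · q) xpq<q) ⟩
  suc (size q)                       ≡⟨ cong (_+ size q) size-true∷p ⟨
  size (true ∷ p) + size q           ∎
  where
  size-true∷p : size (true ∷ p) ≡ 1
  size-true∷p = trans (size-∷ true p) (cong (consSize true) p≡)
  size-xpq : size (false ∷ p · q) ≡ 0
  size-xpq = trans (size-∷ false (p · q)) (cong (consSize false) (size-·-≡0 p q p≡))
  xpq<q : size (false ∷ p · q) < size q
  xpq<q = subst (_< size q) (sym size-xpq) q-pos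
size-· (a ∷ p) q p-pos q-pos | suc m = begin
  suc (size (scale a q ⊕ (false ∷ p · q)))
    ≡⟨ cong suc (size-⊕-≡ʳ (scale a q) (false ∷ p · q) scale<) ⟩
  suc (size (false ∷ p · q))   ≡⟨ cong suc shifted ⟩
  suc (suc (size (p · q)))     ≡⟨ cong suc ih ⟩
  suc (size p + size q)        ≡⟨ cong (_+ size q) (size-∷-pos a p p-pos′) ⟨
  size (a ∷ p) + size q        ∎
  where
  p-pos′ : 1 ≤ size p
  p-pos′ = subst (1 ≤_) (sym p≡) (s≤s z≤n)
  ih : suc (size (p · q)) ≡ size p + size q
  ih = size-· p q p-pos′ q-pos
  q≤pq : size q ≤ size (p · q)
  q≤pq = s≤s⁻¹ (subst (suc (size q) ≤_) (sym ih) (+-monoˡ-≤ (size q) p-pos′))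
  shifted : size (false ∷ p · q) ≡ suc (size (p · q))
  shifted = size-∷-pos false (p · q) (≤-trans q-pos q≤pq)
  scale< : size (scale a q) < size (false ∷ p · q)
  scale< = subst (size (scale a q) <_) (sym shifted) (s≤s (≤-trans (size-scale≤ a q) q≤pq))

eval1-⊕ : ∀ p q → eval1 (p ⊕ q) ≡ eval1 p xor eval1 q
eval1-⊕ [] q = refl
eval1-⊕ (a ∷ p) [] = sym (xor-identityʳ (eval1 (a ∷ p)))
eval1-⊕ (a ∷ p) (b ∷ q) = begin
  (a xor b) xor eval1 (p ⊕ q)            ≡⟨ cong ((a xor b) xor_) (eval1-⊕ p q) ⟩
  (a xor b) xor (eval1 p xor eval1 q)    ≡⟨ interchange a b (eval1 p) (eval1 q) ⟩
  (a xor eval1 p) xor (b xor eval1 q)    ∎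

eval1-· : ∀ p q → eval1 (p · q) ≡ eval1 p ∧ eval1 q
eval1-· [] q = refl
eval1-· (a ∷ p) q = begin
  eval1 (scale a q ⊕ (false ∷ p · q))        ≡⟨ eval1-⊕ (scale a q) (false ∷ p · q) ⟩
  eval1 (scale a q) xor eval1 (p · q)        ≡⟨ cong₂ _xor_ (eval1-scale a) (eval1-· p q) ⟩
  (a ∧ eval1 q) xor (eval1 p ∧ eval1 q)      ≡⟨ ∧-distribʳ-xor (eval1 q) a (eval1 p) ⟨
  (a xor eval1 p) ∧ eval1 q                  ∎
  where
  eval1-scale : ∀ a → eval1 (scale a q) ≡ a ∧ eval1 q
  eval1-scale true = refl
  eval1-scale false = refl

eval1-size≡0 : ∀ p → size p ≡ 0 → eval1 p ≡ false
eval1-size≡0 [] _ = refl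
eval1-size≡0 (c ∷ p) p0 with size-∷-≡0 c p p0
... | refl , p0′ = eval1-size≡0 p p0′

eval1-size≡1 : ∀ p → size p ≡ 1 → eval1 p ≡ true
eval1-size≡1 (c ∷ p) p1 with size-∷-≡1 c p p1
... | refl , p0 = cong not (eval1-size≡0 p p0)

size-divX1 : ∀ p → size (divX1 p) ≡ size p ∸ 1
size-divX1 [] = refl
size-divX1 (a ∷ p) = begin
  size (eval1 p ∷ divX1 p)                ≡⟨ size-∷ (eval1 p) (divX1 p) ⟩
  consSize (eval1 p) (size (divX1 p))     ≡⟨ cong (consSize (eval1 p)) (size-divX1 p) ⟩
  consSize (eval1 p) (size p ∸ 1)         ≡⟨ by-size a (size p) refl ⟩
  consSize a (size p) ∸ 1                 ≡⟨ cong (_∸ 1) (size-∷ a p) ⟨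
  size (a ∷ p) ∸ 1                        ∎
  where
  by-size : ∀ c m → size p ≡ m → consSize (eval1 p) (m ∸ 1) ≡ consSize c m ∸ 1
  by-size true zero p0 rewrite eval1-size≡0 p p0 = refl
  by-size false zero p0 rewrite eval1-size≡0 p p0 = refl
  by-size c 1 p1 rewrite eval1-size≡1 p p1 = refl
  by-size c (suc (suc m)) _ = refl

-- The paper's gcd (s , x (x + 1)) = 1, i.e. s(0) = 1 and s(1) = 1.
Odd : Poly → Set
Odd s = head s ≡ just true × eval1 s ≡ true

head⇒size-pos : ∀ q → head q ≡ just true → 1 ≤ size q
head⇒size-pos (true ∷ r) refl = size-true∷-pos r

head-divX1 : ∀ q → head q ≡ just true → eval1 q ≡ false → head (divX1 q) ≡ just true
head-divX1 (true ∷ r) refl q1≡false =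
  cong just (trans (sym (not-involutive (eval1 r))) (cong not q1≡false))

size≡suc-size-divX1 : ∀ q → 1 ≤ size q → size q ≡ suc (size (divX1 q))
size≡suc-size-divX1 q q-pos = trans (sym (m+[n∸m]≡n q-pos)) (cong suc (sym (size-divX1 q)))

divX1*-spec : ∀ n q → head q ≡ just true → size q ≤ n →
  size q ≡ size (proj₂ (divX1* n q)) + proj₁ (divX1* n q) × Odd (proj₂ (divX1* n q))
divX1*-spec zero q h fuel with ≤-trans (head⇒size-pos q h) fuel
... | ()
divX1*-spec (suc n) q h fuel with eval1 q in q1 | size≡suc-size-divX1 q (head⇒size-pos q h)
... | true | _ = sym (+-identityʳ (size q)) , h , q1
... | false | q≡
  with divX1*-spec n (divX1 q) (head-divX1 q h q1) (s≤s⁻¹ (subst (_≤ suc n) q≡ fuel))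
...   | size≡ , odd = trans q≡ (trans (cong suc size≡) (sym (+-suc _ _))) , odd

divX1*-count-false∷ : ∀ n p → proj₁ (divX1* n (false ∷ p)) ≡ proj₁ (divX1* n p)
divX1*-count-false∷ zero p = refl
divX1*-count-false∷ (suc n) p with eval1 p in p1
... | true = refl
... | false rewrite p1 = cong suc (divX1*-count-false∷ n (divX1 p))

divX1*-count-drop-valX : ∀ n p → proj₁ (divX1* n p) ≡ proj₁ (divX1* n (drop (valX p) p))
divX1*-count-drop-valX n [] = refl
divX1*-count-drop-valX n (true ∷ p) = refl
divX1*-count-drop-valX n (false ∷ p) = trans (divX1*-count-false∷ n p) (divX1*-count-drop-valX n p)

head-drop-valX : ∀ p → 1 ≤ size p → head (drop (valX p) p) ≡ just true
head-drop-valX (true ∷ p) _ = refl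
head-drop-valX (false ∷ p) pos = head-drop-valX p (size-false∷-pos p pos)

size-drop-valX : ∀ p → 1 ≤ size p → size p ≡ size (drop (valX p) p) + valX p
size-drop-valX (true ∷ p) _ = sym (+-identityʳ (size (true ∷ p)))
size-drop-valX (false ∷ p) pos = begin
  size (false ∷ p)                         ≡⟨ size-∷-pos false p pos′ ⟩
  suc (size p)                             ≡⟨ cong suc (size-drop-valX p pos′) ⟩
  suc (size (drop (valX p) p) + valX p)    ≡⟨ +-suc _ (valX p) ⟨
  size (drop (valX p) p) + suc (valX p)    ∎
  where
  pos′ : 1 ≤ size p
  pos′ = size-false∷-pos p pos

oddPart-spec : ∀ p → 1 ≤ size p →
  size p ≡ size (oddPart p) + valX p + valX1 p × Odd (oddPart p)
oddPart-spec p pos = size-eq , proj₂ spec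
  where
  fuel : size (drop (valX p) p) ≤ length p
  fuel = ≤-trans (size≤length (drop (valX p) p))
                 (≤-trans (≤-reflexive (length-drop (valX p) p)) (m∸n≤m (length p) (valX p)))
  spec : size (drop (valX p) p) ≡ size (oddPart p) + proj₁ (divX1* (length p) (drop (valX p) p))
       × Odd (oddPart p)
  spec = divX1*-spec (length p) (drop (valX p) p) (head-drop-valX p pos) fuel
  size-eq : size p ≡ size (oddPart p) + valX p + valX1 p
  size-eq = begin
    size p                                 ≡⟨ size-drop-valX p pos ⟩
    size (drop (valX p) p) + valX p        ≡⟨ cong (_+ valX p) (proj₁ spec) ⟩
    size (oddPart p) + proj₁ (divX1* (length p) (drop (valX p) p)) + valX p
      ≡⟨ cong (λ b → size (oddPart p) + b + valX p) (divX1*-count-drop-valX (length p) p) ⟨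
    size (oddPart p) + valX1 p + valX p    ≡⟨ xy∙z≈xz∙y (size (oddPart p)) (valX1 p) (valX p) ⟩
    size (oddPart p) + valX p + valX1 p    ∎

valX1-pos : ∀ p → 1 ≤ size p → eval1 p ≡ false → 1 ≤ valX1 p
valX1-pos (c ∷ r) _ p1 rewrite p1 = s≤s z≤n

size-M₁· : ∀ s → 1 ≤ size s → size (M₁ · s) ≡ suc (suc (size s))
size-M₁· s pos = suc-injective (size-· M₁ s (s≤s z≤n) pos)

size-1+M₁· : ∀ s → 1 ≤ size s → size (one ⊕ M₁ · s) ≡ suc (suc (size s))
size-1+M₁· s pos = trans (size-⊕-≡ʳ one (M₁ · s) one<M₁s) (size-M₁· s pos)
  where
  one<M₁s : size one < size (M₁ · s)
  one<M₁s = subst (1 <_) (sym (size-M₁· s pos)) (s≤s (s≤s z≤n))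

valX-1+M₁· : ∀ s → head s ≡ just true → 1 ≤ valX (one ⊕ M₁ · s)
valX-1+M₁· (true ∷ r) refl = s≤s z≤n

eval1-1+M₁· : ∀ s → eval1 s ≡ true → eval1 (one ⊕ M₁ · s) ≡ false
eval1-1+M₁· s s1 = begin
  eval1 (one ⊕ M₁ · s)        ≡⟨ eval1-⊕ one (M₁ · s) ⟩
  not (eval1 (M₁ · s))        ≡⟨ cong not (eval1-· M₁ s) ⟩
  not (eval1 s)               ≡⟨ cong not s1 ⟩
  false                       ∎

isEven-+2 : ∀ n → isEven (suc (suc n)) ≡ isEven n
isEven-+2 n with isEven n
... | true = refl
... | false = refl

isEven-2* : ∀ k → isEven (2 * k) ≡ true
isEven-2* zero = refl
isEven-2* (suc k) = trans (cong isEven (*-suc 2 k)) (trans (isEven-+2 (2 * k)) (isEven-2* k))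

isEven-2*+1 : ∀ k → isEven (suc (2 * k)) ≡ false
isEven-2*+1 k rewrite isEven-2* k = refl

collatz-suc-even : ∀ A j → isEven j ≡ true → collatz A (suc j) ≡ oddPart (collatz A j)
collatz-suc-even A j j-even rewrite j-even = refl

collatz-suc-odd : ∀ A j → isEven j ≡ false → collatz A (suc j) ≡ one ⊕ M₁ · collatz A j
collatz-suc-odd A j j-odd rewrite j-odd = refl

collatz-2k+1 : ∀ A k → collatz A (suc (2 * k)) ≡ oddPart (collatz A (2 * k))
collatz-2k+1 A k = collatz-suc-even A (2 * k) (isEven-2* k)

collatz-2k+2 : ∀ A k → collatz A (2 * suc k) ≡ one ⊕ M₁ · collatz A (suc (2 * k))
collatz-2k+2 A k =
  trans (cong (collatz A) (*-suc 2 k)) (collatz-suc-odd A (suc (2 * k)) (isEven-2*+1 k))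

odd⇒size-pos : ∀ s → Odd s → 1 ≤ size s
odd⇒size-pos s (s0 , _) = head⇒size-pos s s0

deg-oddPart : ∀ p → 1 ≤ size p → deg p ≡ deg (oddPart p) + valX p + valX1 p
deg-oddPart p pos = begin
  deg p                                        ≡⟨ cong (_∸ 1) (proj₁ (oddPart-spec p pos)) ⟩
  size (oddPart p) + valX p + valX1 p ∸ 1      ≡⟨ cong (λ n → n + valX p + valX1 p ∸ 1) odd≡ ⟩
  deg (oddPart p) + valX p + valX1 p           ∎
  where
  odd≡ : size (oddPart p) ≡ suc (deg (oddPart p))
  odd≡ = size≡suc-deg (oddPart p) (odd⇒size-pos (oddPart p) (proj₂ (oddPart-spec p pos)))

deg-1+M₁· : ∀ s → 1 ≤ size s → deg (one ⊕ M₁ · s) ≡ deg s + 2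
deg-1+M₁· s pos = begin
  deg (one ⊕ M₁ · s)    ≡⟨ cong (_∸ 1) (size-1+M₁· s pos) ⟩
  suc (size s)          ≡⟨ cong suc (size≡suc-deg s pos) ⟩
  suc (suc (deg s))     ≡⟨ +-comm 2 (deg s) ⟩
  deg s + 2             ∎

m+a+b≡n+2⇒m≤n : ∀ {m n a b} → 1 ≤ a → 1 ≤ b → m + a + b ≡ n + 2 → m ≤ n
m+a+b≡n+2⇒m≤n {m} {n} {a} {b} a-pos b-pos eq =
  +-cancelʳ-≤ 2 m n (≤-trans m+2≤ (≤-reflexive eq))
  where
  m+2≤ : m + 2 ≤ m + a + b
  m+2≤ = ≤-trans (≤-reflexive (sym (+-assoc m 1 1))) (+-mono-≤ (+-monoʳ-≤ m a-pos) b-pos)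

module CollatzTrajectory (A : Poly) (A≢0 : NonZeroPoly A) where

  A[_] : ℕ → Poly
  A[ j ] = collatz A j

  size-A₂ₖ-pos : ∀ k → 1 ≤ size A[ 2 * k ]
  A₂ₖ₊₁-odd : ∀ k → Odd A[ suc (2 * k) ]

  A₂ₖ₊₁-odd k rewrite collatz-2k+1 A k = proj₂ (oddPart-spec A[ 2 * k ] (size-A₂ₖ-pos k))

  size-A₂ₖ-pos zero = nonZero⇒size-pos A A≢0
  size-A₂ₖ-pos (suc k)
    rewrite collatz-2k+2 A k | size-1+M₁· A[ suc (2 * k) ] (odd⇒size-pos _ (A₂ₖ₊₁-odd k)) = s≤s z≤n

  d≡ℓ+a+b : ∀ k → deg A[ 2 * k ] ≡ deg A[ suc (2 * k) ] + valX A[ 2 * k ] + valX1 A[ 2 * k ]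
  d≡ℓ+a+b k rewrite collatz-2k+1 A k = deg-oddPart A[ 2 * k ] (size-A₂ₖ-pos k)

  d≡ℓ+2 : ∀ k → deg A[ 2 * suc k ] ≡ deg A[ suc (2 * k) ] + 2
  d≡ℓ+2 k rewrite collatz-2k+2 A k = deg-1+M₁· A[ suc (2 * k) ] (odd⇒size-pos _ (A₂ₖ₊₁-odd k))

  a₂ₖ₊₂-pos : ∀ k → 1 ≤ valX A[ 2 * suc k ]
  a₂ₖ₊₂-pos k rewrite collatz-2k+2 A k = valX-1+M₁· A[ suc (2 * k) ] (proj₁ (A₂ₖ₊₁-odd k))

  b₂ₖ₊₂-pos : ∀ k → 1 ≤ valX1 A[ 2 * suc k ]
  b₂ₖ₊₂-pos k = valX1-pos A[ 2 * suc k ] (size-A₂ₖ-pos (suc k)) A₂ₖ₊₂⟨1⟩≡0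
    where
    A₂ₖ₊₂⟨1⟩≡0 : eval1 A[ 2 * suc k ] ≡ false
    A₂ₖ₊₂⟨1⟩≡0 rewrite collatz-2k+2 A k = eval1-1+M₁· A[ suc (2 * k) ] (proj₂ (A₂ₖ₊₁-odd k))

  ℓ-antitone : ∀ k → deg A[ suc (2 * suc k) ] ≤ deg A[ suc (2 * k) ]
  ℓ-antitone k =
    m+a+b≡n+2⇒m≤n (a₂ₖ₊₂-pos k) (b₂ₖ₊₂-pos k) (trans (sym (d≡ℓ+a+b (suc k))) (d≡ℓ+2 k))

  ℓ≤deg : ∀ k → deg A[ suc (2 * k) ] ≤ deg A
  ℓ≤deg zero = ≤-trans (m≤m+n _ _) (≤-trans (m≤m+n _ _) (≤-reflexive (sym (d≡ℓ+a+b 0))))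
  ℓ≤deg (suc k) = ≤-trans (ℓ-antitone k) (ℓ≤deg k)

lemma2p3 : (A : Poly) → NonZeroPoly A →
    ((k : ℕ) →
        deg (collatz A (suc (2 * suc k))) ≤ deg (collatz A (suc (2 * k)))
      × deg (collatz A (suc (2 * k))) ≤ deg A
      × deg (collatz A (2 * k))
          ≡ deg (collatz A (suc (2 * k))) + valX (collatz A (2 * k)) + valX1 (collatz A (2 * k)))
    × ((k : ℕ) → 1 ≤ k →
        deg (collatz A (2 * k)) ≡ deg (collatz A (suc (2 * (k ∸ 1)))) + 2)
lemma2p3 A A≢0 = (λ k → ℓ-antitone k , ℓ≤deg k , d≡ℓ+a+b k) , λ { (suc k) _ → d≡ℓ+2 k }
  where open CollatzTrajectory A A≢0
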